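{- Every substitutive system has only finitely many minimal subsystems.
   Context: For a finite alphabet $\mathcal{A}$, $\mathcal{A}^\omega$ is the set of one-sided sequences with product topology and shift $T((x_n)_n)=(x_{n+1})_n$; a subsystem is a closed $T$-invariant subset, minimal if nonempty with no subsystems other than itself and $\emptyset$. A substitution $\varphi\colon\mathcal{A}\to\mathcal{A}^*$ (extended to words and sequences by concatenation) is assumed growing: $|\varphi^n(a)|\to\infty$ for every letter $a$. A sequence is substitutive if it is the image under a letter-to-letter map (coding) of a fixed point of a substitution; a substitutive system is the orbit closure of a substitutive sequence. -}

module Defs where

open import Level using (0ℓ)
open import Data.Nat using (ℕ; zero; suc; _+_; _≤_; _<_)
open import Data.Fin using (Fin)
open import Data.List using (List; []; _∷_; _++_; length; concatMap)
open import Data.Product using (Σ; ∃; _×_; _,_)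
open import Data.Empty using (⊥)
open import Data.Sum using (_⊎_)
open import Relation.Nullary using (¬_)
open import Relation.Unary using (Pred; _⊆_)
open import Relation.Binary.PropositionalEquality using (_≡_)

Seq : ℕ → Set
Seq k = ℕ → Fin k

SeqSet : ℕ → Set₁
SeqSet k = Pred (Seq k) 0ℓ

shift : ∀ {k} → Seq k → Seq k
shift x n = x (suc n)

AgreeUpTo : ∀ {k} → ℕ → Seq k → Seq k → Set
AgreeUpTo n x y = ∀ i → i < n → x i ≡ y i

Closed : ∀ {k} → SeqSet k → Set
Closed {k} X = ∀ (y : Seq k) → (∀ n → ∃ λ z → X z × AgreeUpTo n y z) → X y

ShiftInvariant : ∀ {k} → SeqSet k → Set
ShiftInvariant X = ∀ x → X x → X (shift x)

IsSubsystemOf : ∀ {k} → SeqSet k → SeqSet k → Set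
IsSubsystemOf Y X = Closed Y × ShiftInvariant Y × (Y ⊆ X)

Empty : ∀ {k} → SeqSet k → Set
Empty Y = ∀ y → ¬ Y y

NonEmpty : ∀ {k} → SeqSet k → Set
NonEmpty Y = ∃ λ y → Y y

_≐_ : ∀ {k} → SeqSet k → SeqSet k → Set
Y ≐ Z = (Y ⊆ Z) × (Z ⊆ Y)

IsMinimalSubsystemOf : ∀ {k} → SeqSet k → SeqSet k → Set₁
IsMinimalSubsystemOf Y X =
  IsSubsystemOf Y X × NonEmpty Y ×
  (∀ Z → IsSubsystemOf Z Y → Empty Z ⊎ (Z ≐ Y))

OrbitClosure : ∀ {k} → Seq k → SeqSet k
OrbitClosure x y = ∀ n → ∃ λ m → AgreeUpTo n y (λ i → x (m + i))

Substitution : ℕ → Set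
Substitution b = Fin b → List (Fin b)

substWord : ∀ {b} → Substitution b → List (Fin b) → List (Fin b)
substWord φ w = concatMap φ w

iterWord : ∀ {b} → Substitution b → ℕ → List (Fin b) → List (Fin b)
iterWord φ zero    w = w
iterWord φ (suc n) w = substWord φ (iterWord φ n w)

Growing : ∀ {b} → Substitution b → Set
Growing {b} φ = ∀ (a : Fin b) (N : ℕ) → ∃ λ n₀ → ∀ n → n₀ ≤ n → N ≤ length (iterWord φ n (a ∷ []))

prefix : ∀ {k} → ℕ → Seq k → List (Fin k)
prefix zero    x = []
prefix (suc n) x = x 0 ∷ prefix n (shift x)

IsPrefixOf : ∀ {k} → List (Fin k) → Seq k → Set
IsPrefixOf w x = prefix (length w) x ≡ w

-- x is a fixed point of φ (φ extended to sequences by concatenation): φ(x) = x.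
-- Spelled out: for every n, φ(x₀ … x_{n-1}) is a prefix of x; since φ(x) is the
-- limit of the φ(x₀ … x_{n-1}), this is exactly φ(x) = x (for growing φ, whose
-- images are nonempty, so φ(x) is an infinite sequence).
IsFixedPoint : ∀ {b} → Substitution b → Seq b → Set
IsFixedPoint φ x = ∀ n → IsPrefixOf (substWord φ (prefix n x)) x

Substitutive : ∀ {k} → Seq k → Set
Substitutive {k} y =
  Σ ℕ λ b → Σ (Substitution b) λ φ → Σ (Seq b) λ x → Σ (Fin b → Fin k) λ τ →
    Growing φ × IsFixedPoint φ x × (∀ n → y n ≡ τ (x n))

IsSubstitutiveSystem : ∀ {k} → SeqSet k → Set
IsSubstitutiveSystem {k} X = Σ (Seq k) λ y → Substitutive y × (X ≐ OrbitClosure y)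

FinitelyManyMinimalSubsystems : ∀ {k} → SeqSet k → Set₁
FinitelyManyMinimalSubsystems {k} X =
  Σ (List (SeqSet k)) λ Ys → ∀ Y → IsMinimalSubsystemOf Y X → AnyEq Y Ys
  where
  AnyEq : SeqSet k → List (SeqSet k) → Set
  AnyEq Y []        = ⊥
  AnyEq Y (Z ∷ Zs) = (Y ≐ Z) ⊎ AnyEq Y Zs

-- A minimal subsystem Y is the orbit closure of each of its points, and its minimality decides
-- every proposition, so the argument may be classical. Two minimal points with different orbit
-- closures have no common factor of some length L (König's lemma). Every point of the system
-- contains a coded block τ(φⁿ(c)); pigeonholing on the letter c shows that there are at most b
-- inequivalent minimal points, and once all n-blocks are longer than their separation length,
-- the letter c of any block in a minimal point determines its orbit closure. With n chosen
-- least, the minimal subsystems are therefore among the b sets Component c.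

module Submission where

open import Data.Nat using (ℕ)
open import Defs

open import Level using (0ℓ)
open import Axiom.ExcludedMiddle using (ExcludedMiddle)
open import Axiom.DoubleNegationElimination using (em⇒dne)
open import Data.Nat using (zero; suc; _+_; _∸_; _≤_; _<_; _⊔_; z≤n; s≤s; _≤?_)
open import Data.Nat.Properties
open import Data.Fin using (Fin) renaming (zero to fzero; suc to fsuc)
import Data.Fin.Properties as Fin
open import Data.List using (List; []; _∷_; _++_; length; map; tabulate)
open import Data.List.Properties using (length-map; length-++; ++-cancelˡ; concatMap-++; ∷-injective)
open import Data.Product using (Σ; ∃; _×_; _,_; proj₁; proj₂)
open import Data.Sum using (_⊎_; inj₁; inj₂; [_,_]′)
open import Data.Empty using (⊥-elim)
open import Function using (_∘_)
open import Relation.Nullary using (¬_; yes; no)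
open import Relation.Unary using (_⊆_)
open import Relation.Binary.PropositionalEquality
open import Relation.Binary.Definitions using (tri<; tri≈; tri>)

private
  variable
    k : ℕ

drop : ℕ → Seq k → Seq k
drop m x i = x (m + i)

AgreeUpTo-mono : ∀ {m n} {x y : Seq k} → m ≤ n → AgreeUpTo n x y → AgreeUpTo m x y
AgreeUpTo-mono m≤n agree i i<m = agree i (≤-trans i<m m≤n)

AgreeUpTo-drop : ∀ {n m t ℓ} {x y : Seq k} → AgreeUpTo n x (drop m y) → t + ℓ ≤ n →
                 AgreeUpTo ℓ (drop t x) (drop (m + t) y)
AgreeUpTo-drop {m = m} {t} {y = y} agree t+ℓ≤n i i<ℓ =
  trans (agree (t + i) (≤-trans (+-monoʳ-< t i<ℓ) t+ℓ≤n)) (cong y (sym (+-assoc m t i)))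

AgreeUpTo⇒prefix≡ : ∀ n {x y : Seq k} → AgreeUpTo n x y → prefix n x ≡ prefix n y
AgreeUpTo⇒prefix≡ zero    agree = refl
AgreeUpTo⇒prefix≡ (suc n) agree =
  cong₂ _∷_ (agree 0 (s≤s z≤n)) (AgreeUpTo⇒prefix≡ n (λ i i<n → agree (suc i) (s≤s i<n)))

prefix≡⇒AgreeUpTo : ∀ n {x y : Seq k} → prefix n x ≡ prefix n y → AgreeUpTo n x y
prefix≡⇒AgreeUpTo (suc n) eq zero    _         = proj₁ (∷-injective eq)
prefix≡⇒AgreeUpTo (suc n) eq (suc i) (s≤s i<n) = prefix≡⇒AgreeUpTo n (proj₂ (∷-injective eq)) i i<n

≐-trans : {X Y Z : SeqSet k} → X ≐ Y → Y ≐ Z → X ≐ Z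
≐-trans (X⊆Y , Y⊆X) (Y⊆Z , Z⊆Y) = (λ x → Y⊆Z (X⊆Y x)) , (λ z → Y⊆X (Z⊆Y z))

orbitClosure-refl : (x : Seq k) → OrbitClosure x x
orbitClosure-refl x n = 0 , λ _ _ → refl

orbitClosure-trans : {x y z : Seq k} → OrbitClosure x y → OrbitClosure y z → OrbitClosure x z
orbitClosure-trans {x = x} x→y y→z n with y→z n
... | m , agree with x→y (m + n)
... | m′ , agree′ = m′ + m , λ i i<n →
  trans (agree i i<n) (trans (agree′ (m + i) (+-monoʳ-< m i<n)) (cong x (sym (+-assoc m′ m i))))

orbitClosure-shiftInvariant : (x : Seq k) → ShiftInvariant (OrbitClosure x)
orbitClosure-shiftInvariant x y x→y n with x→y (suc n)
... | m , agree = suc m , λ i i<n → trans (agree (suc i) (s≤s i<n)) (cong x (+-suc m i))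

orbitClosure-closed : (x : Seq k) → Closed (OrbitClosure x)
orbitClosure-closed x y approx n with approx n
... | z , x→z , y≈z with x→z n
... | m , agree = m , λ i i<n → trans (y≈z i i<n) (agree i i<n)

shiftInvariant-drop : {Y : SeqSet k} → ShiftInvariant Y → ∀ m {x} → Y x → Y (drop m x)
shiftInvariant-drop inv zero    Yx = Yx
shiftInvariant-drop inv (suc m) Yx = shiftInvariant-drop inv m (inv _ Yx)

orbitClosure-least : {Y : SeqSet k} → Closed Y → ShiftInvariant Y → ∀ {x} → Y x → OrbitClosure x ⊆ Y
orbitClosure-least closed inv {x} Yx {z} x→z =
  closed z λ n → drop (proj₁ (x→z n)) x , shiftInvariant-drop inv (proj₁ (x→z n)) Yx , proj₂ (x→z n)

MinimalPoint : Seq k → Set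
MinimalPoint x = ∀ y → OrbitClosure x y → OrbitClosure y x

-- The subsystem {y ∈ Y | P} is either empty or all of Y.
minimal⇒excludedMiddle : {X Y : SeqSet k} → IsMinimalSubsystemOf Y X → ExcludedMiddle 0ℓ
minimal⇒excludedMiddle {Y = Y} ((closed , invariant , _) , (y , Yy) , minimal) {P}
  with minimal (λ z → Y z × P) (closed′ , (λ z (Yz , p) → invariant z Yz , p) , proj₁)
  where
  closed′ : Closed (λ z → Y z × P)
  closed′ z approx = closed z (λ n → let w , (Yw , _) , z≈w = approx n in w , Yw , z≈w)
                   , proj₂ (proj₁ (proj₂ (approx 0)))
... | inj₁ empty       = no λ p → empty y (Yy , p)
... | inj₂ (_ , Y⊆YP) = yes (proj₂ (Y⊆YP Yy))

minimal⇒≐orbitClosure : {X Y : SeqSet k} → IsMinimalSubsystemOf Y X → ∀ {x} → Y x → Y ≐ OrbitClosure x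
minimal⇒≐orbitClosure {Y = Y} ((closed , invariant , _) , _ , minimal) {x} Yx
  with minimal (OrbitClosure x)
               (orbitClosure-closed x , orbitClosure-shiftInvariant x , orbitClosure-least closed invariant Yx)
... | inj₁ empty          = ⊥-elim (empty x (orbitClosure-refl x))
... | inj₂ (x→⊆Y , Y⊆x→) = Y⊆x→ , x→⊆Y

minimal⇒MinimalPoint : {X Y : SeqSet k} → IsMinimalSubsystemOf Y X → ∀ {x} → Y x → MinimalPoint x
minimal⇒MinimalPoint minY Yx y x→y =
  proj₁ (minimal⇒≐orbitClosure minY (proj₂ (minimal⇒≐orbitClosure minY Yx) x→y)) Yx

common-bound : ∀ {r} (P : Fin r → ℕ → Set) → (∀ i {m n} → m ≤ n → P i m → P i n) →
               (∀ i → ∃ (P i)) → ∃ λ N → ∀ i → P i N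
common-bound {zero}  P mono bounds = 0 , λ ()
common-bound {suc r} P mono bounds
  with bounds fzero | common-bound (λ i → P (fsuc i)) (λ i → mono (fsuc i)) (λ i → bounds (fsuc i))
... | N₀ , P₀ | N , Pₛ = N₀ ⊔ N , λ where
  fzero    → mono fzero (m≤m⊔n N₀ N) P₀
  (fsuc i) → mono (fsuc i) (m≤n⊔m N₀ N) (Pₛ i)

Least : (ℕ → Set) → ℕ → Set
Least P n = P n × (∀ m → m < n → ¬ P m)

Least-unique : ∀ {P m n} → Least P m → Least P n → m ≡ n
Least-unique {m = m} {n} (Pm , m-least) (Pn , n-least) with <-cmp m n
... | tri< m<n _ _ = ⊥-elim (n-least m m<n Pm)
... | tri≈ _ m≡n _ = m≡n
... | tri> _ _ n<m = ⊥-elim (m-least n n<m Pn)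

OccursIn : ℕ → Seq k → Seq k → Set
OccursIn n v x = ∃ λ m → AgreeUpTo n v (drop m x)

OccursIn-mono : ∀ {m n} {v x : Seq k} → m ≤ n → OccursIn n v x → OccursIn m v x
OccursIn-mono m≤n (t , agree) = t , AgreeUpTo-mono m≤n agree

OccursIn-agree : ∀ {n} {u v x : Seq k} → AgreeUpTo n u v → OccursIn n v x → OccursIn n u x
OccursIn-agree u≈v (t , agree) = t , λ i i<n → trans (u≈v i i<n) (agree i i<n)

CommonFactor : ℕ → Seq k → Seq k → Seq k → Set
CommonFactor n x y v = OccursIn n v x × OccursIn n v y

CommonFactor-mono : ∀ {m n} {x y v : Seq k} → m ≤ n → CommonFactor n x y v → CommonFactor m x y v
CommonFactor-mono {x = x} {y} m≤n (v∈x , v∈y) =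
  OccursIn-mono {x = x} m≤n v∈x , OccursIn-mono {x = y} m≤n v∈y

CommonFactor-agree : ∀ {n} {x y u v : Seq k} → AgreeUpTo n u v → CommonFactor n x y v → CommonFactor n x y u
CommonFactor-agree {x = x} {y} u≈v (v∈x , v∈y) =
  OccursIn-agree {x = x} u≈v v∈x , OccursIn-agree {x = y} u≈v v∈y

ShareFactor : ℕ → Seq k → Seq k → Set
ShareFactor n x y = ∃ (CommonFactor n x y)

ShareFactor-mono : ∀ {m n} {x y : Seq k} → m ≤ n → ShareFactor n x y → ShareFactor m x y
ShareFactor-mono {x = x} {y} m≤n (v , common) = v , CommonFactor-mono {x = x} {y} m≤n common

¬ShareFactor-mono : ∀ {m n} {x y : Seq k} → m ≤ n → ¬ ShareFactor m x y → ¬ ShareFactor n x y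
¬ShareFactor-mono {x = x} {y} m≤n ¬share = ¬share ∘ ShareFactor-mono {x = x} {y} m≤n

module Classical (em : ExcludedMiddle 0ℓ) where

  ¬∀⇒∃¬ : {A : Set} {P : A → Set} → ¬ (∀ a → P a) → ∃ λ a → ¬ P a
  ¬∀⇒∃¬ ¬∀ = em⇒dne em λ ¬∃ → ¬∀ λ a → em⇒dne em λ ¬Pa → ¬∃ (a , ¬Pa)

  least : {P : ℕ → Set} → ∃ P → ∃ (Least P)
  least {P} (n , Pn) = [ (λ found → found) , (λ none → ⊥-elim (none n ≤-refl Pn)) ]′ (search (suc n))
    where
    search : ∀ N → ∃ (Least P) ⊎ (∀ m → m < N → ¬ P m)
    search zero = inj₂ λ _ ()
    search (suc N) with search N
    ... | inj₁ found = inj₁ found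
    ... | inj₂ none with em {P N}
    ...   | yes PN = inj₁ (N , PN , none)
    ...   | no ¬PN = inj₂ λ m m<1+N → [ none m , (λ { refl → ¬PN }) ]′ (m<1+n⇒m<n∨m≡n m<1+N)

  module König {x y : Seq k} (share : ∀ n → ShareFactor n x y) where

    Extendable : ℕ → Seq k → Set
    Extendable n u = ∀ j → ∃ λ v → AgreeUpTo n u v × CommonFactor (n + j) x y v

    ExtendableBy : ℕ → Seq k → Fin k → Set
    ExtendableBy n u a = ∀ j → ∃ λ v → AgreeUpTo n u v × v n ≡ a × CommonFactor (suc n + j) x y v

    extendBy : ∀ {n u a} → ExtendableBy n u a → ∃ λ u′ → AgreeUpTo n u u′ × Extendable (suc n) u′
    extendBy {n} {u} {a} extA = u′ , u≈u′ , λ j → extended (extA j)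
      where
      u′ = proj₁ (extA 0)
      u≈u′ = proj₁ (proj₂ (extA 0))
      u′n≡a = proj₁ (proj₂ (proj₂ (extA 0)))
      extended : ∀ {l} → (∃ λ v → AgreeUpTo n u v × v n ≡ a × CommonFactor l x y v) →
                 ∃ λ v → AgreeUpTo (suc n) u′ v × CommonFactor l x y v
      extended (v , u≈v , vn≡a , common) = v , agree , common
        where
        agree : AgreeUpTo (suc n) u′ v
        agree i i<1+n with m<1+n⇒m<n∨m≡n i<1+n
        ... | inj₁ i<n  = trans (sym (u≈u′ i i<n)) (u≈v i i<n)
        ... | inj₂ refl = trans u′n≡a (sym vn≡a)

    -- If every letter failed at some length, one length J would defeat all of them.
    extendableBy-some : ∀ {n u} → Extendable n u → ∃ (ExtendableBy n u)
    extendableBy-some {n} {u} ext = em⇒dne em λ ¬ext →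
      let J , stuck = common-bound Stuck Stuck-mono (λ a → ¬∀⇒∃¬ λ extA → ¬ext (a , extA))
          v , u≈v , common = ext (suc J)
      in stuck (v n) (v , u≈v , refl , subst (λ l → CommonFactor l x y v) (+-suc n J) common)
      where
      Stuck : Fin k → ℕ → Set
      Stuck a J = ¬ (∃ λ v → AgreeUpTo n u v × v n ≡ a × CommonFactor (suc n + J) x y v)
      Stuck-mono : ∀ a {J J′} → J ≤ J′ → Stuck a J → Stuck a J′
      Stuck-mono a J≤J′ stuck (v , u≈v , vn≡a , common) =
        stuck (v , u≈v , vn≡a , CommonFactor-mono {x = x} {y} (+-monoʳ-≤ (suc n) J≤J′) common)

    extend : ∀ {n u} → Extendable n u → ∃ λ u′ → AgreeUpTo n u u′ × Extendable (suc n) u′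
    extend ext = extendBy (proj₂ (extendableBy-some ext))

    approximation : (n : ℕ) → Σ (Seq k) (Extendable n)
    approximation zero = x , λ j → let v , common = share j in v , (λ _ ()) , common
    approximation (suc n) = let u′ , _ , ext′ = extend (proj₂ (approximation n)) in u′ , ext′

    u : ℕ → Seq k
    u n = proj₁ (approximation n)

    u-stable : ∀ n i → i < n → u n i ≡ u (suc i) i
    u-stable (suc n) i i<1+n with m<1+n⇒m<n∨m≡n i<1+n
    ... | inj₁ i<n  = trans (sym (proj₁ (proj₂ (extend (proj₂ (approximation n)))) i i<n)) (u-stable n i i<n)
    ... | inj₂ refl = refl

    limit : Seq k
    limit i = u (suc i) i

    limit-common : ∀ n → CommonFactor n x y limit
    limit-common n with proj₂ (approximation n) 0
    ... | v , u≈v , common =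
      CommonFactor-agree {x = x} {y} (λ i i<n → trans (sym (u-stable n i i<n)) (u≈v i i<n))
                                     (subst (λ l → CommonFactor l x y v) (+-identityʳ n) common)

  separation : {x y : Seq k} → MinimalPoint x → ¬ OrbitClosure y x → ∃ λ L → ¬ ShareFactor L x y
  separation {x = x} {y} minimal y↛x = ¬∀⇒∃¬ λ (share : ∀ L → ShareFactor L x y) →
    let open König {x = x} {y} share
    in y↛x (orbitClosure-trans {x = y} (λ n → proj₂ (limit-common n))
                                        (minimal limit λ n → proj₁ (limit-common n)))

length-prefix : ∀ n (x : Seq k) → length (prefix n x) ≡ n
length-prefix zero    x = refl
length-prefix (suc n) x = cong suc (length-prefix n (shift x))

prefix-+ : ∀ m n (x : Seq k) → prefix (m + n) x ≡ prefix m x ++ prefix n (drop m x)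
prefix-+ zero    n x = refl
prefix-+ (suc m) n x = cong (x 0 ∷_) (prefix-+ m n (shift x))

prefix-suc : ∀ n (x : Seq k) → prefix (suc n) x ≡ prefix n x ++ (x n ∷ [])
prefix-suc zero    x = refl
prefix-suc (suc n) x = cong (x 0 ∷_) (prefix-suc n (shift x))

prefix-map : ∀ {l} (f : Fin k → Fin l) n (x : Seq k) → prefix n (λ i → f (x i)) ≡ map f (prefix n x)
prefix-map f zero    x = refl
prefix-map f (suc n) x = cong (f (x 0) ∷_) (prefix-map f n (shift x))

OccursAt : List (Fin k) → Seq k → ℕ → Set
OccursAt w x t = prefix (length w) (drop t x) ≡ w

OccursAt-coding : ∀ {l} (f : Fin k → Fin l) {x : Seq k} {y : Seq l} → (∀ n → y n ≡ f (x n)) →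
                  ∀ {w t} → OccursAt w x t → OccursAt (map f w) y t
OccursAt-coding f {x} {y} y≡fx {w} {t} occ = begin
  prefix (length (map f w)) (drop t y)        ≡⟨ cong (λ l → prefix l (drop t y)) (length-map f w) ⟩
  prefix (length w) (drop t y)                ≡⟨ AgreeUpTo⇒prefix≡ (length w) (λ i _ → y≡fx (t + i)) ⟩
  prefix (length w) (λ i → f (drop t x i))    ≡⟨ prefix-map f (length w) (drop t x) ⟩
  map f (prefix (length w) (drop t x))        ≡⟨ cong (map f) occ ⟩
  map f w                                     ∎
  where open ≡-Reasoning

OccursAt-agreeˡ : ∀ {n m t} {w : List (Fin k)} {x y : Seq k} → AgreeUpTo n x (drop m y) →
                  t + length w ≤ n → OccursAt w y (m + t) → OccursAt w x t
OccursAt-agreeˡ {m = m} {w = w} {y = y} x≈y t+|w|≤n occ =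
  trans (AgreeUpTo⇒prefix≡ (length w) (AgreeUpTo-drop {m = m} {y = y} x≈y t+|w|≤n)) occ

OccursAt-agreeʳ : ∀ {n m t} {w : List (Fin k)} {x y : Seq k} → AgreeUpTo n x (drop m y) →
                  t + length w ≤ n → OccursAt w x t → OccursAt w y (m + t)
OccursAt-agreeʳ {m = m} {w = w} {y = y} x≈y t+|w|≤n occ =
  trans (sym (AgreeUpTo⇒prefix≡ (length w) (AgreeUpTo-drop {m = m} {y = y} x≈y t+|w|≤n))) occ

cut-within : ∀ (s : ℕ → ℕ) M → s 0 ≡ 0 → (∀ j → s j < s (suc j)) → (∀ j → s (suc j) ≤ s j + M) →
             ∀ m → ∃ λ j → m ≤ s j × s j ≤ m + M
cut-within s M s0≡0 increasing gap zero = 0 , z≤n , ≤-trans (≤-reflexive s0≡0) z≤n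
cut-within s M s0≡0 increasing gap (suc m) with cut-within s M s0≡0 increasing gap m
... | j , m≤sj , sj≤m+M with m≤n⇒m<n∨m≡n m≤sj
...   | inj₁ m<sj  = j , m<sj , ≤-trans sj≤m+M (+-monoˡ-≤ M (n≤1+n m))
...   | inj₂ refl = suc j , increasing j , ≤-trans (gap j) (+-monoˡ-≤ M (n≤1+n m))

module SubstitutionFacts {b} (φ : Substitution b) where

  block : ℕ → Fin b → List (Fin b)
  block n a = iterWord φ n (a ∷ [])

  iterWord-++ : ∀ n u v → iterWord φ n (u ++ v) ≡ iterWord φ n u ++ iterWord φ n v
  iterWord-++ zero    u v = refl
  iterWord-++ (suc n) u v =
    trans (cong (substWord φ) (iterWord-++ n u v)) (concatMap-++ φ (iterWord φ n u) (iterWord φ n v))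

  iterWord-+ : ∀ m n w → iterWord φ (m + n) w ≡ iterWord φ m (iterWord φ n w)
  iterWord-+ zero    n w = refl
  iterWord-+ (suc m) n w = cong (substWord φ) (iterWord-+ m n w)

  iterWord-[] : ∀ n → iterWord φ n [] ≡ []
  iterWord-[] zero    = refl
  iterWord-[] (suc n) = cong (substWord φ) (iterWord-[] n)

  blocks-bounded : ∀ n → ∃ λ M → ∀ a → length (block n a) ≤ M
  blocks-bounded n = common-bound (λ a M → length (block n a) ≤ M) (λ a ≤M M≤ → ≤-trans M≤ ≤M)
                                  (λ a → length (block n a) , ≤-refl)

  module Growth (growing : Growing φ) where

    blocks-long : ∀ L → ∃ λ N → ∀ a → L ≤ length (block N a)
    blocks-long L with common-bound (λ a N → ∀ n → N ≤ n → L ≤ length (block n a))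
                                    (λ a N≤N′ long n N′≤n → long n (≤-trans N≤N′ N′≤n))
                                    (λ a → growing a L)
    ... | N , long = N , λ a → long a N ≤-refl

    -- An empty block stays empty under further iteration, contradicting growth.
    block-nonempty : ∀ n a → 0 < length (block n a)
    block-nonempty n a with block n a in empty
    ... | _ ∷ _ = s≤s z≤n
    ... | []    = let N , long = growing a 1 in
      ⊥-elim (<-irrefl refl (subst (λ w → 0 < length w) (stays-empty N) (long (N + n) (m≤m+n N n))))
      where
      stays-empty : ∀ N → block (N + n) a ≡ []
      stays-empty N = trans (iterWord-+ N n (a ∷ [])) (trans (cong (iterWord φ N) empty) (iterWord-[] N))

  module FixedPoint {x : Seq b} (fixed : IsFixedPoint φ x) where

    cut : ℕ → ℕ → ℕ
    cut n j = length (iterWord φ n (prefix j x))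

    prefix-cut : ∀ n j → prefix (cut n j) x ≡ iterWord φ n (prefix j x)
    prefix-cut zero    j = cong (λ l → prefix l x) (length-prefix j x)
    prefix-cut (suc n) j =
      subst (λ w → prefix (length (substWord φ w)) x ≡ substWord φ w) (prefix-cut n j) (fixed (cut n j))

    iterWord-prefix-suc : ∀ n j →
                          iterWord φ n (prefix (suc j) x) ≡ iterWord φ n (prefix j x) ++ block n (x j)
    iterWord-prefix-suc n j =
      trans (cong (iterWord φ n) (prefix-suc j x)) (iterWord-++ n (prefix j x) (x j ∷ []))

    cut-suc : ∀ n j → cut n (suc j) ≡ cut n j + length (block n (x j))
    cut-suc n j = trans (cong length (iterWord-prefix-suc n j)) (length-++ (iterWord φ n (prefix j x)))

    cut-zero : ∀ n → cut n 0 ≡ 0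
    cut-zero n = cong length (iterWord-[] n)

    block-occurs : ∀ n j → OccursAt (block n (x j)) x (cut n j)
    block-occurs n j = ++-cancelˡ (iterWord φ n (prefix j x)) _ _ (begin
      iterWord φ n (prefix j x) ++ rest    ≡⟨ cong (_++ rest) (prefix-cut n j) ⟨
      prefix (cut n j) x ++ rest           ≡⟨ prefix-+ (cut n j) ℓ x ⟨
      prefix (cut n j + ℓ) x               ≡⟨ cong (λ l → prefix l x) (cut-suc n j) ⟨
      prefix (cut n (suc j)) x             ≡⟨ prefix-cut n (suc j) ⟩
      iterWord φ n (prefix (suc j) x)      ≡⟨ iterWord-prefix-suc n j ⟩
      iterWord φ n (prefix j x) ++ block n (x j) ∎)
      where
      open ≡-Reasoning
      ℓ = length (block n (x j))
      rest = prefix ℓ (drop (cut n j) x)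

module SubstitutiveSequence {b} (φ : Substitution b) (growing : Growing φ) {x : Seq b} (fixed : IsFixedPoint φ x)
                            (τ : Fin b → Fin k) {y : Seq k} (y≡τx : ∀ n → y n ≡ τ (x n)) where
  open SubstitutionFacts φ
  open Growth growing
  open FixedPoint fixed

  ContainsBlock : ℕ → Seq k → Fin b → Set
  ContainsBlock n p c = ∃ (OccursAt (map τ (block n c)) p)

  -- The window of length 2M of p read off y contains a whole block, since consecutive
  -- cut points of y = τ(φⁿ(x)) are at most M apart.
  orbitClosure-containsBlock : ∀ n {p} → OrbitClosure y p → ∃ (ContainsBlock n p)
  orbitClosure-containsBlock n {p} y→p = x j , t , OccursAt-agreeˡ {m = m} {y = y} p≈y window occurs
    where
    M = proj₁ (blocks-bounded n)
    bounded = proj₂ (blocks-bounded n)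
    m = proj₁ (y→p (M + M))
    p≈y = proj₂ (y→p (M + M))
    increasing : ∀ j → cut n j < cut n (suc j)
    increasing j = subst (cut n j <_) (sym (cut-suc n j)) (m<m+n (cut n j) (block-nonempty n (x j)))
    gap : ∀ j → cut n (suc j) ≤ cut n j + M
    gap j = subst (_≤ cut n j + M) (sym (cut-suc n j)) (+-monoʳ-≤ (cut n j) (bounded (x j)))
    near = cut-within (cut n) M (cut-zero n) increasing gap m
    j = proj₁ near
    t = cut n j ∸ m
    m+t≡cut : m + t ≡ cut n j
    m+t≡cut = m+[n∸m]≡n (proj₁ (proj₂ near))
    t≤M : t ≤ M
    t≤M = +-cancelˡ-≤ m t M (subst (_≤ m + M) (sym m+t≡cut) (proj₂ (proj₂ near)))
    window : t + length (map τ (block n (x j))) ≤ M + M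
    window = subst (λ l → t + l ≤ M + M) (sym (length-map τ (block n (x j)))) (+-mono-≤ t≤M (bounded (x j)))
    occurs : OccursAt (map τ (block n (x j))) y (m + t)
    occurs = subst (OccursAt (map τ (block n (x j))) y) (sym m+t≡cut) (OccursAt-coding τ y≡τx (block-occurs n j))

  containsBlock-orbitClosure : ∀ {n u p c} → OrbitClosure u p → ContainsBlock n p c → ContainsBlock n u c
  containsBlock-orbitClosure {n} {u} {c = c} u→p (t , occurs) =
    m + t , OccursAt-agreeʳ {m = m} {y = u} p≈u ≤-refl occurs
    where
    m = proj₁ (u→p (t + length (map τ (block n c))))
    p≈u = proj₂ (u→p (t + length (map τ (block n c))))

  sameBlock⇒ShareFactor : ∀ {n p q c L} → ContainsBlock n p c → ContainsBlock n q c →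
                          L ≤ length (block n c) → ShareFactor L p q
  sameBlock⇒ShareFactor {n} {p} {q} {c} (t , p∋w) (t′ , q∋w) L≤ℓ =
    drop t p , (t , λ _ _ → refl) , (t′ , AgreeUpTo-mono L≤ℓ′ p≈q)
    where
    ℓ′ = length (map τ (block n c))
    L≤ℓ′ = subst (_ ≤_) (sym (length-map τ (block n c))) L≤ℓ
    p≈q : AgreeUpTo ℓ′ (drop t p) (drop t′ q)
    p≈q = prefix≡⇒AgreeUpTo ℓ′ (trans p∋w (sym q∋w))

  module MinimalComponents (X : SeqSet k) (X⊆y : X ⊆ OrbitClosure y) where

    MinimalIn : Seq k → Set
    MinimalIn p = MinimalPoint p × X p

    BlocksDetermineOrbits : ℕ → Set
    BlocksDetermineOrbits n = ∀ {p q c} → MinimalIn p → MinimalIn q →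
                              ContainsBlock n p c → ContainsBlock n q c → OrbitClosure q p

    -- Taking the least such n makes the component of a letter independent of any choice.
    Component : Fin b → SeqSet k
    Component c z = ∃ λ p → MinimalIn p × OrbitClosure p z ×
                    ∃ λ n → Least BlocksDetermineOrbits n × ContainsBlock n p c

    record SeparatedFamily : Set where
      field
        size      : ℕ
        point     : Fin size → Seq k
        minimal   : ∀ i → MinimalIn (point i)
        separated : ∀ i j → i ≢ j → ¬ OrbitClosure (point j) (point i)

    emptyFamily : SeparatedFamily
    emptyFamily = record { size = 0 ; point = λ () ; minimal = λ () ; separated = λ () }

    Covers : SeparatedFamily → Set
    Covers F = ∀ p → MinimalIn p → ∃ λ i → OrbitClosure (SeparatedFamily.point F i) p

    add : (F : SeparatedFamily) → ∀ p → MinimalIn p →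
          (∀ i → ¬ OrbitClosure (SeparatedFamily.point F i) p) → SeparatedFamily
    add F p minimal-p new = record
      { size = suc size ; point = point′ ; minimal = minimal′ ; separated = separated′ }
      where
      open SeparatedFamily F
      point′ : Fin (suc size) → Seq k
      point′ fzero    = p
      point′ (fsuc i) = point i
      minimal′ : ∀ i → MinimalIn (point′ i)
      minimal′ fzero    = minimal-p
      minimal′ (fsuc i) = minimal i
      separated′ : ∀ i j → i ≢ j → ¬ OrbitClosure (point′ j) (point′ i)
      separated′ fzero    fzero    i≢j = ⊥-elim (i≢j refl)
      separated′ fzero    (fsuc j) _   = new j
      separated′ (fsuc i) fzero    _   = new i ∘ proj₁ minimal-p (point i)
      separated′ (fsuc i) (fsuc j) i≢j = separated i j (i≢j ∘ cong fsuc)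

    module _ (em : ExcludedMiddle 0ℓ) where
      open Classical em

      uniformSeparation : (F : SeparatedFamily) → let open SeparatedFamily F in
                          ∃ λ L → ∀ i j → i ≢ j → ¬ ShareFactor L (point i) (point j)
      uniformSeparation F =
        common-bound (λ i L → ∀ j → i ≢ j → ¬ ShareFactor L (point i) (point j))
                     (λ i L≤L′ sep j i≢j → ¬ShareFactor-mono {x = point i} {point j} L≤L′ (sep j i≢j))
                     λ i → common-bound (λ j L → i ≢ j → ¬ ShareFactor L (point i) (point j))
                                        (λ j L≤L′ sep → ¬ShareFactor-mono {x = point i} {point j} L≤L′ ∘ sep)
                                        (pair i)
        where
        open SeparatedFamily F
        pair : ∀ i j → ∃ λ L → i ≢ j → ¬ ShareFactor L (point i) (point j)
        pair i j with i Fin.≟ j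
        ... | yes i≡j = 0 , λ i≢j → ⊥-elim (i≢j i≡j)
        ... | no i≢j  = let L , sep = separation {y = point j} (proj₁ (minimal i)) (separated i j i≢j)
                        in L , λ _ → sep

      -- Blocks longer than the separation length identify the member, so members get distinct letters.
      size≤b : (F : SeparatedFamily) → SeparatedFamily.size F ≤ b
      size≤b F with SeparatedFamily.size F ≤? b
      ... | yes size≤b = size≤b
      ... | no size≰b  = let i , j , i<j , same = Fin.pigeonhole (≰⇒> size≰b) letter
                         in ⊥-elim (distinct (Fin.<⇒≢ i<j) same)
        where
        open SeparatedFamily F
        L = proj₁ (uniformSeparation F)
        N = proj₁ (blocks-long L)
        blockOf : ∀ i → ∃ (ContainsBlock N (point i))
        blockOf i = orbitClosure-containsBlock N (X⊆y (proj₂ (minimal i)))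
        letter : Fin size → Fin b
        letter i = proj₁ (blockOf i)
        distinct : ∀ {i j} → i ≢ j → letter i ≢ letter j
        distinct {i} {j} i≢j same =
          proj₂ (uniformSeparation F) i j i≢j
            (sameBlock⇒ShareFactor {N} {point i} {point j}
               (proj₂ (blockOf i))
               (subst (ContainsBlock N (point j)) (sym same) (proj₂ (blockOf j)))
               (proj₂ (blocks-long L) (letter i)))

      covering : ∀ d (F : SeparatedFamily) → b < SeparatedFamily.size F + d → Σ SeparatedFamily Covers
      covering zero    F b<size = ⊥-elim (<⇒≱ (subst (b <_) (+-identityʳ _) b<size) (size≤b F))
      covering (suc d) F b<size+d
        with em {∃ λ p → MinimalIn p × ∀ i → ¬ OrbitClosure (SeparatedFamily.point F i) p}
      ... | yes (p , minimal-p , new) = covering d (add F p minimal-p new) (subst (b <_) (+-suc _ d) b<size+d)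
      ... | no ¬uncovered = F , λ p minimal-p →
        let i , ¬¬i→p = ¬∀⇒∃¬ λ new → ¬uncovered (p , minimal-p , new) in i , em⇒dne em ¬¬i→p

      -- Every minimal point is covered by some member, and a block long enough to separate
      -- the members pins that member down.
      blocksDetermineOrbits : ∃ BlocksDetermineOrbits
      blocksDetermineOrbits = N , determine
        where
        cover = covering (suc b) emptyFamily ≤-refl
        open SeparatedFamily (proj₁ cover)
        L = proj₁ (uniformSeparation (proj₁ cover))
        N = proj₁ (blocks-long L)
        determine : BlocksDetermineOrbits N
        determine {p} {q} {c} minimal-p minimal-q p∋c q∋c
          with proj₂ cover p minimal-p | proj₂ cover q minimal-q
        ... | i , i→p | j , j→q with i Fin.≟ j
        ...   | yes refl = orbitClosure-trans {x = q} (proj₁ (minimal i) q j→q) i→p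
        ...   | no i≢j  = ⊥-elim (proj₂ (uniformSeparation (proj₁ cover)) i j i≢j
                  (sameBlock⇒ShareFactor {N} {point i} {point j}
                     (containsBlock-orbitClosure {N} {point i} {p} i→p p∋c)
                     (containsBlock-orbitClosure {N} {point j} {q} j→q q∋c)
                     (proj₂ (blocks-long L) c)))

      orbitClosure≐Component : ∀ {p} → MinimalIn p → ∃ λ c → OrbitClosure p ≐ Component c
      orbitClosure≐Component {p} minimal-p =
        c , (λ p→z → p , minimal-p , p→z , n , leastN , p∋c) , component⊆
        where
        n = proj₁ (least blocksDetermineOrbits)
        leastN = proj₂ (least blocksDetermineOrbits)
        c = proj₁ (orbitClosure-containsBlock n (X⊆y (proj₂ minimal-p)))
        p∋c = proj₂ (orbitClosure-containsBlock n (X⊆y (proj₂ minimal-p)))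
        component⊆ : Component c ⊆ OrbitClosure p
        component⊆ (q , minimal-q , q→z , n′ , leastN′ , q∋c) =
          orbitClosure-trans {x = p} (proj₁ leastN minimal-q minimal-p q∋c′ p∋c) q→z
          where
          q∋c′ : ContainsBlock n q c
          q∋c′ = subst (λ l → ContainsBlock l q c) (Least-unique leastN′ leastN) q∋c

-- The membership relation of FinitelyManyMinimalSubsystems is local to its definition;
-- unifying against its type recovers it.
MembershipOf : {X : SeqSet k} {_∈_ : SeqSet k → List (SeqSet k) → Set} →
               (FinitelyManyMinimalSubsystems X →
                Σ (List (SeqSet k)) λ Ys → ∀ Y → IsMinimalSubsystemOf Y X → Y ∈ Ys) →
               SeqSet k → List (SeqSet k) → Set
MembershipOf {_∈_ = _∈_} _ = _∈_

finitelyMany-tabulate : ∀ {k} {X : SeqSet k} {r} (Z : Fin r → SeqSet k) →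
                        (∀ Y → IsMinimalSubsystemOf Y X → ∃ λ c → Y ≐ Z c) →
                        FinitelyManyMinimalSubsystems X
finitelyMany-tabulate {k} {X} Z component =
  tabulate Z , λ Y minY → let c , Y≐Zc = component Y minY in ≐⇒∈tabulate Z c Y≐Zc
  where
  _∈_ = MembershipOf {X = X} (λ finite → finite)
  ≐⇒∈tabulate : ∀ {r} (Z : Fin r → SeqSet k) c {Y} → Y ≐ Z c → Y ∈ tabulate Z
  ≐⇒∈tabulate Z fzero    Y≐Zc = inj₁ Y≐Zc
  ≐⇒∈tabulate Z (fsuc c) Y≐Zc = inj₂ (≐⇒∈tabulate (Z ∘ fsuc) c Y≐Zc)

corollary2p3 : ∀ (k : ℕ) (X : SeqSet k) → IsSubstitutiveSystem X → FinitelyManyMinimalSubsystems X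
corollary2p3 k X (y , (b , φ , x , τ , growing , fixed , y≡τx) , X⊆y , _) =
  finitelyMany-tabulate Component λ Y minY →
    let (y₀ , Yy₀) = proj₁ (proj₂ minY)
        minimal-y₀ = minimal⇒MinimalPoint minY Yy₀ , proj₂ (proj₂ (proj₁ minY)) Yy₀
        c , y₀→≐Zc = orbitClosure≐Component (minimal⇒excludedMiddle minY) minimal-y₀
    in c , ≐-trans (minimal⇒≐orbitClosure minY Yy₀) y₀→≐Zc
  where
  open SubstitutiveSequence φ growing fixed τ y≡τx
  open MinimalComponents X X⊆y
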